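{- Let $\Sigma$ be a finite alphabet and $f\colon\Sigma^n\to\{0,1\}$ a Boolean function. Then $\mathrm{Adv}_s(f)\ge K_\infty(f)$, where for defining $\mathrm{Adv}_s(f)$, $f$ is treated as a function on $\{0,1\}^{n\cdot\lceil\log|\Sigma|\rceil}$ via a fixed binary encoding of each symbol of $\Sigma$ by $\lceil\log|\Sigma|\rceil$ bits.
   Context: The soft-adversary bound of $g\colon\{0,1\}^N\to\{0,1\}$ is $\mathrm{Adv}_s(g)=\max_{(\mathbf{a},\mathbf{b})}\min_{a\in\mathrm{supp}\,\mathbf{a},\,i\in[N]}\frac{1}{\Pr[\mathbf{a}_i\ne\mathbf{b}_i\mid\mathbf{a}=a]}\cdot\min_{b\in\mathrm{supp}\,\mathbf{b},\,i\in[N]}\frac{1}{\Pr[\mathbf{a}_i\ne\mathbf{b}_i\mid\mathbf{b}=b]}$, the max over distributions supported on $g^{ -1}(1)\times g^{ -1}(0)$. A Khrapchenko distribution for $f\colon\Sigma^n\to\{0,1\}$ is a distribution $(\mathbf{a},\mathbf{b})$ on $f^{ -1}(1)\times f^{ -1}(0)$ such that $\mathbf{a},\mathbf{b}$ always differ in exactly one coordinate $\mathbf{i}\in[n]$. $H_\infty(\mathbf{x}\mid\mathbf{y})=\min_{x,y}\log\frac{1}{\Pr[\mathbf{x}=x\mid\mathbf{y}=y]}$ (base 2). $K_\infty(f)$ is the maximum of $2^{H_\infty(\mathbf{i}\mid\mathbf{a})+H_\infty(\mathbf{i}\mid\mathbf{b})}$ over Khrapchenko distributions for $f$.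
   Formalization: The Khrapchenko distributions over which $K_\infty(f)$ is maximised have rational weights, and the soft-adversary distribution witnessing the bound is likewise taken with rational weights. -}

module Defs where

open import Data.Bool using (Bool; true; false; _∧_; not)
open import Data.Nat using (ℕ; _*_)
open import Data.Nat.Logarithm using (⌈log₂_⌉)
open import Data.Fin using (Fin)
import Data.Fin.Properties as FinP
open import Data.Vec using (Vec; lookup; concat; map)
open import Data.Vec.Properties using (≡-dec)
open import Data.List using (List; foldr; allFin; concatMap; filter)
import Data.List as List
open import Data.List.Relation.Unary.All using (All)
open import Data.Product using (_×_; _,_; proj₁; proj₂; Σ)
open import Data.Rational using (ℚ; 0ℚ; 1ℚ; _+_; _<_; _≤_; _⊔_; 1/_; ≢-nonZero)
import Data.Rational as ℚ
open import Data.Rational.Properties using (_≟_)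
open import Relation.Nullary using (¬_; yes; no; does)
open import Relation.Binary.PropositionalEquality using (_≡_; _≢_)
open import Relation.Binary.Definitions using (DecidableEquality)
open import Function.Definitions using (Injective)

-- Inverse on ℚ with the convention inv 0 = 0 (only ever applied to
-- quantities that are strictly positive under the hypotheses).
inv : ℚ → ℚ
inv q with q ≟ 0ℚ
... | yes _ = 0ℚ
... | no q≢0 = 1/_ q {{≢-nonZero q≢0}}

sumℚ : List ℚ → ℚ
sumℚ = foldr _+_ 0ℚ

record Dist (A : Set) : Set where
  field
    support  : List (ℚ × A)
    positive : All (λ e → 0ℚ < proj₁ e) support
    total    : sumℚ (List.map proj₁ support) ≡ 1ℚ
open Dist public

Pr : {A : Set} → Dist A → (A → Bool) → ℚ
Pr μ P = sumℚ (List.map proj₁ (filter (λ e → P (proj₂ e) Data.Bool.≟ true) (support μ)))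

maxℚ : List ℚ → ℚ
maxℚ = foldr _⊔_ 0ℚ

module Pairs {B : Set} (_≟B_ : DecidableEquality B) {m : ℕ} where

  Word : Set
  Word = Vec B m

  eqW : Word → Word → Bool
  eqW x y = does (≡-dec _≟B_ x y)

  diffAt : Fin m → Word × Word → Bool
  diffAt i (a , b) = not (does (lookup a i ≟B lookup b i))

  condA : Dist (Word × Word) → Word → Fin m → ℚ
  condA μ a0 i = Pr μ (λ p → diffAt i p ∧ eqW (proj₁ p) a0) ℚ.* inv (Pr μ (λ p → eqW (proj₁ p) a0))

  condB : Dist (Word × Word) → Word → Fin m → ℚ
  condB μ b0 i = Pr μ (λ p → diffAt i p ∧ eqW (proj₂ p) b0) ℚ.* inv (Pr μ (λ p → eqW (proj₂ p) b0))

  maxCondA : Dist (Word × Word) → ℚ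
  maxCondA μ = maxℚ (concatMap (λ e → List.map (condA μ (proj₁ (proj₂ e))) (allFin m)) (support μ))

  maxCondB : Dist (Word × Word) → ℚ
  maxCondB μ = maxℚ (concatMap (λ e → List.map (condB μ (proj₂ (proj₂ e))) (allFin m)) (support μ))

  -- (min_{a,i} 1/Pr[..|a]) · (min_{b,i} 1/Pr[..|b])
  --   = 1 / (max_{a,i} Pr[..|a] · max_{b,i} Pr[..|b])
  -- (entries with probability 0 contribute +∞ to the minima and are irrelevant).
  pairValue : Dist (Word × Word) → ℚ
  pairValue μ = inv (maxCondA μ ℚ.* maxCondB μ)

IsSoftAdvDist : {N : ℕ} → (Vec Bool N → Bool) → Dist (Vec Bool N × Vec Bool N) → Set
IsSoftAdvDist g μ = All (λ e → g (proj₁ (proj₂ e)) ≡ true × g (proj₂ (proj₂ e)) ≡ false) (support μ)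

softAdvValue : {N : ℕ} → Dist (Vec Bool N × Vec Bool N) → ℚ
softAdvValue = Pairs.pairValue Data.Bool._≟_

DifferInExactlyOne : {S : Set} {n : ℕ} → Vec S n → Vec S n → Set
DifferInExactlyOne {n = n} a b =
  Σ (Fin n) λ i → (lookup a i ≢ lookup b i) × (∀ j → j ≢ i → lookup a j ≡ lookup b j)

IsKhrapchenkoDist : {s n : ℕ} → (Vec (Fin s) n → Bool) → Dist (Vec (Fin s) n × Vec (Fin s) n) → Set
IsKhrapchenkoDist f μ =
  All (λ e → f (proj₁ (proj₂ e)) ≡ true × f (proj₂ (proj₂ e)) ≡ false
             × DifferInExactlyOne (proj₁ (proj₂ e)) (proj₂ (proj₂ e))) (support μ)

-- 2^{H∞(i|a) + H∞(i|b)} for a Khrapchenko distribution, where i is the unique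
-- coordinate in which a and b differ, so the event "i = j" is "a_j ≠ b_j":
-- 2^{H∞(i|a)} = 1 / max_{a,j} Pr[i = j | a = a], likewise for b.
khrapchenkoValue : {s n : ℕ} → Dist (Vec (Fin s) n × Vec (Fin s) n) → ℚ
khrapchenkoValue = Pairs.pairValue FinP._≟_

codeLen : ℕ → ℕ
codeLen s = ⌈log₂ s ⌉

encodeWord : {s n : ℕ} → (Fin s → Vec Bool (codeLen s)) → Vec (Fin s) n → Vec Bool (n * codeLen s)
encodeWord enc x = concat (map enc x)

{-# OPTIONS --safe #-}
module Submission where

-- Push the distribution forward along the encoding E. Conditioning on E a is conditioning on a,
-- as E is injective, and bit k of E a can differ from bit k of E b only if the symbol in the
-- block containing k differs. So each conditional probability Pr[a_k ≠ b_k | a] of the pushed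
-- distribution is bounded by one of the original ones, and likewise for b: both maxima can only
-- shrink, and the value, the reciprocal of their product, can only grow. The pushed maxima stay
-- positive because f separates a from b, so E a and E b differ in some bit.

open import Defs
open import Data.Bool using (Bool; true; false; _∧_; not)
import Data.Bool as Bool
open import Data.Nat using (ℕ; _*_)
open import Data.Fin using (Fin; remQuot; combine)
import Data.Fin.Properties as FinP
open import Data.Vec using (Vec; []; _∷_; lookup)
import Data.Vec as Vec
open import Data.Vec.Properties using (≡-dec; lookup-concat; lookup-map; ++-injective; tabulate∘lookup; tabulate-cong)
open import Data.List using (List; []; _∷_; filter; allFin; concatMap)
import Data.List as List
import Data.List.Properties as List
open import Data.List.Relation.Unary.All as All using (All; []; _∷_)
import Data.List.Relation.Unary.All.Properties as All
open import Data.List.Relation.Unary.Any using (here; there)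
open import Data.List.Membership.Propositional using (_∈_; find)
open import Data.List.Membership.Propositional.Properties using (∈-map⁺; ∈-map⁻; ∈-allFin; ∈-concat⁺′; ∈-concatMap⁻)
open import Data.Product using (Σ; ∃; _×_; _,_; proj₁; proj₂; map₂)
import Data.Product as Product
open import Data.Rational using (ℚ; 0ℚ; _+_; _<_; _≤_; 1/_; Positive; NonNegative; nonNegative; ≢-nonZero)
import Data.Rational as ℚ
open import Data.Rational.Properties
import Data.Rational.Unnormalised.Properties as ℚᵘ
open import Relation.Nullary using (yes; no)
open import Relation.Nullary.Decidable using (dec-true; dec-false; does-⇔)
open import Relation.Nullary.Negation using (contradiction)
open import Relation.Binary.Definitions using (DecidableEquality)
open import Relation.Binary.PropositionalEquality using (_≡_; _≢_; refl; sym; trans; cong; cong₂; subst; module ≡-Reasoning)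
open import Function.Bundles using (mk⇔)
open import Function.Base using (_∘_)
open import Function.Definitions using (Injective)

1/-antimono-≤-pos : ∀ {p q} .{{_ : Positive p}} .{{_ : Positive q}} →
                    p ≤ q → (1/ q) {{pos⇒nonZero q}} ≤ (1/ p) {{pos⇒nonZero p}}
1/-antimono-≤-pos {p} {q} p≤q = toℚᵘ-cancel-≤
  (ℚᵘ.≤-respˡ-≃ (ℚᵘ.≃-sym (toℚᵘ-homo-1/ q {{pos⇒nonZero q}}))
  (ℚᵘ.≤-respʳ-≃ (ℚᵘ.≃-sym (toℚᵘ-homo-1/ p {{pos⇒nonZero p}}))
  (ℚᵘ.1/-antimono-≤-pos (toℚᵘ-mono-≤ p≤q))))

p≤q+p : ∀ p q .{{_ : NonNegative q}} → p ≤ q + p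
p≤q+p p q = subst (_≤ q + p) (+-identityˡ p) (+-monoˡ-≤ p (nonNegative⁻¹ q))

*-pos : ∀ {p q} → 0ℚ < p → 0ℚ < q → 0ℚ < p ℚ.* q
*-pos {p} {q} p>0 q>0 = positive⁻¹ _ {{pos*pos⇒pos p {{ℚ.positive p>0}} q {{ℚ.positive q>0}}}}

*-mono-≤-nonNeg : ∀ {p p′ q q′} → 0ℚ ≤ q → 0ℚ ≤ p′ → p ≤ p′ → q ≤ q′ → p ℚ.* q ≤ p′ ℚ.* q′
*-mono-≤-nonNeg {p} {p′} {q} {q′} q≥0 p′≥0 p≤p′ q≤q′ =
  ≤-trans (*-monoʳ-≤-nonNeg q {{nonNegative q≥0}} p≤p′) (*-monoˡ-≤-nonNeg p′ {{nonNegative p′≥0}} q≤q′)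

inv-pos≡1/ : ∀ {q} (q>0 : 0ℚ < q) → inv q ≡ (1/ q) {{pos⇒nonZero q {{ℚ.positive q>0}}}}
inv-pos≡1/ {q} q>0 with q ≟ 0ℚ
... | yes q≡0 = contradiction (sym q≡0) (<⇒≢ q>0)
... | no _    = refl

inv-pos : ∀ {q} → 0ℚ < q → 0ℚ < inv q
inv-pos {q} q>0 = subst (0ℚ <_) (sym (inv-pos≡1/ q>0)) (positive⁻¹ _ {{1/pos⇒pos q {{ℚ.positive q>0}}}})

inv-nonNeg : ∀ {q} → 0ℚ ≤ q → 0ℚ ≤ inv q
inv-nonNeg {q} q≥0 with q ≟ 0ℚ
... | yes _   = ≤-refl
... | no q≢0  = <⇒≤ (positive⁻¹ _ {{1/pos⇒pos q {{q>0}}}})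
  where
  q>0 : Positive q
  q>0 = nonNeg∧nonZero⇒pos q {{nonNegative q≥0}} {{≢-nonZero q≢0}}

inv-antimono-≤ : ∀ {p q} → 0ℚ < p → p ≤ q → inv q ≤ inv p
inv-antimono-≤ {p} {q} p>0 p≤q
  rewrite inv-pos≡1/ p>0 | inv-pos≡1/ (<-≤-trans p>0 p≤q) =
  1/-antimono-≤-pos {{ℚ.positive p>0}} {{ℚ.positive (<-≤-trans p>0 p≤q)}} p≤q

maxℚ-nonNeg : ∀ xs → 0ℚ ≤ maxℚ xs
maxℚ-nonNeg []       = ≤-refl
maxℚ-nonNeg (x ∷ xs) = ≤-trans (maxℚ-nonNeg xs) (p≤q⊔p x _)

≤-maxℚ : ∀ {x xs} → x ∈ xs → x ≤ maxℚ xs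
≤-maxℚ {xs = y ∷ xs} (here refl) = p≤p⊔q y _
≤-maxℚ {xs = y ∷ xs} (there x∈) = ≤-trans (≤-maxℚ x∈) (p≤q⊔p y _)

maxℚ-lub : ∀ {c} xs → 0ℚ ≤ c → (∀ {x} → x ∈ xs → x ≤ c) → maxℚ xs ≤ c
maxℚ-lub []       c≥0 xs≤c = c≥0
maxℚ-lub (x ∷ xs) c≥0 xs≤c = ⊔-lub (xs≤c (here refl)) (maxℚ-lub xs c≥0 (xs≤c ∘ there))

∧-mono-true : ∀ {x x′ y y′} → (x ≡ true → x′ ≡ true) → (y ≡ true → y′ ≡ true) →
              x ∧ y ≡ true → x′ ∧ y′ ≡ true
∧-mono-true {true} {y = true} x⇒x′ y⇒y′ _ rewrite x⇒x′ refl | y⇒y′ refl = refl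

≢⇒lookup-≢ : ∀ {A : Set} → DecidableEquality A → ∀ {m} {u v : Vec A m} →
             u ≢ v → ∃ λ k → lookup u k ≢ lookup v k
≢⇒lookup-≢ _≟A_ {m} {u} {v} u≢v =
  FinP.¬∀⟶∃¬ m _ (λ k → lookup u k ≟A lookup v k) (λ u≗v → u≢v (lookup-injective u≗v))
  where
  lookup-injective : (∀ k → lookup u k ≡ lookup v k) → u ≡ v
  lookup-injective u≗v = trans (sym (tabulate∘lookup u)) (trans (tabulate-cong u≗v) (tabulate∘lookup v))

module _ {A : Set} where

  mass : (A → Bool) → List (ℚ × A) → ℚ
  mass P l = sumℚ (List.map proj₁ (filter (λ e → P (proj₂ e) Bool.≟ true) l))

  PositiveWeights : List (ℚ × A) → Set
  PositiveWeights = All (λ e → 0ℚ < proj₁ e)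

  mass-nonNeg : ∀ P {l} → PositiveWeights l → 0ℚ ≤ mass P l
  mass-nonNeg P []                      = ≤-refl
  mass-nonNeg P {(w , x) ∷ l} (w>0 ∷ ws) with P x
  ... | true  = ≤-trans (mass-nonNeg P ws) (p≤q+p _ w {{nonNegative (<⇒≤ w>0)}})
  ... | false = mass-nonNeg P ws

  mass-mono : ∀ {P Q} {l} → PositiveWeights l → (∀ x → P x ≡ true → Q x ≡ true) → mass P l ≤ mass Q l
  mass-mono []                                 P⇒Q = ≤-refl
  mass-mono {P} {Q} {(w , x) ∷ l} (w>0 ∷ ws) P⇒Q with P x in Px | Q x in Qx
  ... | true  | true  = +-monoʳ-≤ w (mass-mono ws P⇒Q)
  ... | true  | false = contradiction (trans (sym (P⇒Q x Px)) Qx) (λ ())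
  ... | false | true  = ≤-trans (mass-mono ws P⇒Q) (p≤q+p _ w {{nonNegative (<⇒≤ w>0)}})
  ... | false | false = mass-mono ws P⇒Q

  mass-cong : ∀ {P Q} l → (∀ x → P x ≡ Q x) → mass P l ≡ mass Q l
  mass-cong []            P≗Q = refl
  mass-cong {P} {Q} ((w , x) ∷ l) P≗Q rewrite P≗Q x with Q x
  ... | true  = cong (w +_) (mass-cong l P≗Q)
  ... | false = mass-cong l P≗Q

  weight≤mass : ∀ P {w x l} → (w , x) ∈ l → PositiveWeights l → P x ≡ true → w ≤ mass P l
  weight≤mass P {w} {l = _ ∷ l} (here refl) (_ ∷ ws) Px rewrite Px =
    subst (_≤ w + mass P l) (+-identityʳ w) (+-monoʳ-≤ w (mass-nonNeg P ws))
  weight≤mass P {l = (w′ , x′) ∷ l} (there e∈l) (w′>0 ∷ ws) Px with P x′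
  ... | true  = ≤-trans (weight≤mass P e∈l ws Px) (p≤q+p _ w′ {{nonNegative (<⇒≤ w′>0)}})
  ... | false = weight≤mass P e∈l ws Px

mass-map : ∀ {A C : Set} (h : A → C) P (l : List (ℚ × A)) → mass P (List.map (map₂ h) l) ≡ mass (P ∘ h) l
mass-map h P []            = refl
mass-map h P ((w , x) ∷ l) with P (h x)
... | true  = cong (w +_) (mass-map h P l)
... | false = mass-map h P l

mapDist : {A C : Set} → (A → C) → Dist A → Dist C
mapDist h μ = record
  { support  = List.map (map₂ h) (support μ)
  ; positive = All.map⁺ (positive μ)
  ; total    = trans (sym (cong sumℚ (List.map-∘ (support μ)))) (total μ)
  }

Pr-mapDist : ∀ {A C : Set} (h : A → C) μ P → Pr (mapDist h μ) P ≡ Pr μ (P ∘ h)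
Pr-mapDist h μ P = mass-map h P (support μ)

support-inhabited : {A : Set} (μ : Dist A) → ∃ λ e → e ∈ support μ
support-inhabited μ with support μ | total μ
... | []    | 0≡1 = contradiction (sym 0≡1) 1≢0
... | e ∷ _ | _   = e , here refl

data Side : Set where
  left right : Side

pick : {X : Set} → Side → X × X → X
pick left  = proj₁
pick right = proj₂

pick-map : ∀ {X Y : Set} σ (h : X → Y) (p : X × X) → pick σ (Product.map h h p) ≡ h (pick σ p)
pick-map left  h p = refl
pick-map right h p = refl

-- `cond left` and `cond right` unfold to `condA` and `condB`, so `pairValue μ` is definitionally
-- `inv (maxCond left μ * maxCond right μ)`.
module SidedPairs {B : Set} (_≟B_ : DecidableEquality B) {m : ℕ} where
  open Pairs _≟B_ {m} public

  sideIs : Side → Word → Word × Word → Bool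
  sideIs σ w p = eqW (pick σ p) w

  cond : Side → Dist (Word × Word) → Word → Fin m → ℚ
  cond σ μ w i = Pr μ (λ p → diffAt i p ∧ sideIs σ w p) ℚ.* inv (Pr μ (sideIs σ w))

  conds : Side → Dist (Word × Word) → List ℚ
  conds σ μ = concatMap (λ e → List.map (cond σ μ (pick σ (proj₂ e))) (allFin m)) (support μ)

  maxCond : Side → Dist (Word × Word) → ℚ
  maxCond σ μ = maxℚ (conds σ μ)

  sideIs-pick : ∀ σ p → sideIs σ (pick σ p) p ≡ true
  sideIs-pick σ p = dec-true (≡-dec _≟B_ (pick σ p) (pick σ p)) refl

  diffAt-≢ : ∀ a b {i} → lookup a i ≢ lookup b i → diffAt i (a , b) ≡ true
  diffAt-≢ a b {i} aᵢ≢bᵢ = cong not (dec-false (lookup a i ≟B lookup b i) aᵢ≢bᵢ)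

  diffAt⇒≢ : ∀ a b {i} → diffAt i (a , b) ≡ true → lookup a i ≢ lookup b i
  diffAt⇒≢ a b {i} dᵢ aᵢ≡bᵢ =
    contradiction (trans (sym dᵢ) (cong not (dec-true (lookup a i ≟B lookup b i) aᵢ≡bᵢ))) λ ()

  cond-pos : ∀ σ μ {w a b} i → (w , (a , b)) ∈ support μ → lookup a i ≢ lookup b i →
             0ℚ < cond σ μ (pick σ (a , b)) i
  cond-pos σ μ {w} {a} {b} i e∈ aᵢ≢bᵢ = *-pos
      (<-≤-trans w>0 (weight≤mass _ e∈ (positive μ) (cong₂ _∧_ (diffAt-≢ a b aᵢ≢bᵢ) picked)))
      (inv-pos (<-≤-trans w>0 (weight≤mass _ e∈ (positive μ) picked)))
    where
    picked : sideIs σ (pick σ (a , b)) (a , b) ≡ true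
    picked = sideIs-pick σ (a , b)
    w>0 : 0ℚ < w
    w>0 = All.lookup (positive μ) e∈

  cond≤maxCond : ∀ σ μ {e} i → e ∈ support μ → cond σ μ (pick σ (proj₂ e)) i ≤ maxCond σ μ
  cond≤maxCond σ μ i e∈ = ≤-maxℚ (∈-concat⁺′ (∈-map⁺ _ (∈-allFin i)) (∈-map⁺ _ e∈))

  maxCond-lub : ∀ σ μ {c} → 0ℚ ≤ c → (∀ {e} i → e ∈ support μ → cond σ μ (pick σ (proj₂ e)) i ≤ c) →
                maxCond σ μ ≤ c
  maxCond-lub σ μ c≥0 conds≤c = maxℚ-lub (conds σ μ) c≥0 λ x∈ →
    let (e , e∈ , x∈condsₑ) = find (∈-concatMap⁻ _ {xs = support μ} x∈)
        (i , _ , x≡) = ∈-map⁻ _ x∈condsₑ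
    in subst (_≤ _) (sym x≡) (conds≤c i e∈)

  maxCond-pos : ∀ σ μ {w a b} i → (w , (a , b)) ∈ support μ → lookup a i ≢ lookup b i → 0ℚ < maxCond σ μ
  maxCond-pos σ μ i e∈ aᵢ≢bᵢ = <-≤-trans (cond-pos σ μ i e∈ aᵢ≢bᵢ) (cond≤maxCond σ μ i e∈)

module Pushforward {A B : Set} (_≟A_ : DecidableEquality A) (_≟B_ : DecidableEquality B) {n m : ℕ}
  (h : Vec A n → Vec B m) (h-injective : Injective _≡_ _≡_ h) (block : Fin m → Fin n)
  (h-local : ∀ x y k → lookup x (block k) ≡ lookup y (block k) → lookup (h x) k ≡ lookup (h y) k)
  where

  module S = SidedPairs _≟A_ {n}
  module T = SidedPairs _≟B_ {m}

  h² : Vec A n × Vec A n → Vec B m × Vec B m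
  h² = Product.map h h

  push : Dist (Vec A n × Vec A n) → Dist (Vec B m × Vec B m)
  push = mapDist h²

  sideIs-push : ∀ σ w p → T.sideIs σ (h w) (h² p) ≡ S.sideIs σ w p
  sideIs-push σ w p = trans (cong (λ v → T.eqW v (h w)) (pick-map σ h p))
    (does-⇔ (mk⇔ h-injective (cong h)) (≡-dec _≟B_ (h (pick σ p)) (h w)) (≡-dec _≟A_ (pick σ p) w))

  diffAt-push : ∀ k {p} → T.diffAt k (h² p) ≡ true → S.diffAt (block k) p ≡ true
  diffAt-push k {a , b} dₖ = S.diffAt-≢ a b (T.diffAt⇒≢ (h a) (h b) dₖ ∘ h-local a b k)

  cond-push-≤ : ∀ σ μ w k → T.cond σ (push μ) (h w) k ≤ S.cond σ μ w (block k)
  cond-push-≤ σ μ w k = begin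
      Pr (push μ) Dₖ ℚ.* inv (Pr (push μ) (T.sideIs σ (h w)))
        ≡⟨ cong₂ (λ x y → x ℚ.* inv y) (Pr-mapDist h² μ Dₖ)
                 (trans (Pr-mapDist h² μ _) (mass-cong (support μ) (sideIs-push σ w))) ⟩
      Pr μ (Dₖ ∘ h²) ℚ.* inv Pσ
        ≤⟨ *-monoʳ-≤-nonNeg (inv Pσ) {{nonNegative (inv-nonNeg (mass-nonNeg _ (positive μ)))}}
             (mass-mono (positive μ) λ p → ∧-mono-true (diffAt-push k) (trans (sym (sideIs-push σ w p)))) ⟩
      S.cond σ μ w (block k) ∎
    where
    open ≤-Reasoning
    Dₖ : Vec B m × Vec B m → Bool
    Dₖ q = T.diffAt k q ∧ T.sideIs σ (h w) q
    Pσ : ℚ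
    Pσ = Pr μ (S.sideIs σ w)

  maxCond-push-≤ : ∀ σ μ → T.maxCond σ (push μ) ≤ S.maxCond σ μ
  maxCond-push-≤ σ μ = T.maxCond-lub σ (push μ) (maxℚ-nonNeg (S.conds σ μ)) bound
    where
    bound : ∀ {e} k → e ∈ support (push μ) → T.cond σ (push μ) (pick σ (proj₂ e)) k ≤ S.maxCond σ μ
    bound k e∈ with ∈-map⁻ _ e∈
    ... | (w , p) , e∈μ , refl = begin
      T.cond σ (push μ) (pick σ (h² p)) k ≡⟨ cong (λ v → T.cond σ (push μ) v k) (pick-map σ h p) ⟩
      T.cond σ (push μ) (h (pick σ p)) k ≤⟨ cond-push-≤ σ μ (pick σ p) k ⟩
      S.cond σ μ (pick σ p) (block k)    ≤⟨ S.cond≤maxCond σ μ (block k) e∈μ ⟩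
      S.maxCond σ μ                      ∎
      where open ≤-Reasoning

  pairValue-≤-push : ∀ μ {w a b} → (w , (a , b)) ∈ support μ → a ≢ b →
                     S.pairValue μ ≤ T.pairValue (push μ)
  pairValue-≤-push μ {w} {a} {b} e∈ a≢b with ≢⇒lookup-≢ _≟B_ (a≢b ∘ h-injective)
  ... | k , hₖ≢ =
    inv-antimono-≤ (*-pos (T.maxCond-pos left ν k pushed∈ hₖ≢) (T.maxCond-pos right ν k pushed∈ hₖ≢))
      (*-mono-≤-nonNeg (maxℚ-nonNeg (T.conds right ν)) (maxℚ-nonNeg (S.conds left μ))
        (maxCond-push-≤ left μ) (maxCond-push-≤ right μ))
    where
    ν : Dist (Vec B m × Vec B m)
    ν = push μ
    pushed∈ : (w , (h a , h b)) ∈ support ν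
    pushed∈ = ∈-map⁺ (map₂ h²) e∈

module _ {s : ℕ} (enc : Fin s → Vec Bool (codeLen s)) where

  encodeWord-injective : Injective _≡_ _≡_ enc → ∀ {n} → Injective _≡_ _≡_ (encodeWord {n = n} enc)
  encodeWord-injective enc-inj {x = []}    {[]}    _  = refl
  encodeWord-injective enc-inj {x = a ∷ x} {b ∷ y} eq =
    let (heads≡ , tails≡) = ++-injective (enc a) (enc b) eq
    in cong₂ _∷_ (enc-inj heads≡) (encodeWord-injective enc-inj tails≡)

  block : ∀ {n} → Fin (n * codeLen s) → Fin n
  block {n} k = proj₁ (remQuot {n} (codeLen s) k)

  lookup-encodeWord : ∀ {n} (x : Vec (Fin s) n) k →
    lookup (encodeWord enc x) k ≡ lookup (enc (lookup x (block k))) (proj₂ (remQuot {n} (codeLen s) k))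
  lookup-encodeWord {n} x k = begin
    lookup (encodeWord enc x) k             ≡⟨ cong (lookup (encodeWord enc x)) (FinP.combine-remQuot {n} (codeLen s) k) ⟨
    lookup (encodeWord enc x) (combine i j) ≡⟨ lookup-concat (Vec.map enc x) i j ⟩
    lookup (lookup (Vec.map enc x) i) j     ≡⟨ cong (λ v → lookup v j) (lookup-map i enc x) ⟩
    lookup (enc (lookup x i)) j             ∎
    where
    open ≡-Reasoning
    i : Fin n
    i = proj₁ (remQuot {n} (codeLen s) k)
    j : Fin (codeLen s)
    j = proj₂ (remQuot {n} (codeLen s) k)

  encodeWord-local : ∀ {n} (x y : Vec (Fin s) n) k → lookup x (block k) ≡ lookup y (block k) →
                     lookup (encodeWord enc x) k ≡ lookup (encodeWord enc y) k
  encodeWord-local x y k xₖ≡yₖ = begin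
    lookup (encodeWord enc x) k         ≡⟨ lookup-encodeWord x k ⟩
    lookup (enc (lookup x (block k))) _ ≡⟨ cong (λ c → lookup (enc c) _) xₖ≡yₖ ⟩
    lookup (enc (lookup y (block k))) _ ≡⟨ lookup-encodeWord y k ⟨
    lookup (encodeWord enc y) k         ∎
    where open ≡-Reasoning

khrapchenko-pair-≢ : ∀ {s n} (f : Vec (Fin s) n → Bool) μ → IsKhrapchenkoDist f μ →
                     ∀ {w a b} → (w , (a , b)) ∈ support μ → a ≢ b
khrapchenko-pair-≢ f μ khr e∈ a≡b with All.lookup khr e∈
... | fa , fb , _ = contradiction (trans (sym fa) (trans (cong f a≡b) fb)) λ ()

lemma6p12 : (s n : ℕ) (f : Vec (Fin s) n → Bool)
            (enc : Fin s → Vec Bool (codeLen s)) → Injective _≡_ _≡_ enc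
            → (g : Vec Bool (n * codeLen s) → Bool) → (∀ x → g (encodeWord enc x) ≡ f x)
            → (μ : Dist (Vec (Fin s) n × Vec (Fin s) n)) → IsKhrapchenkoDist f μ
            → Σ (Dist (Vec Bool (n * codeLen s) × Vec Bool (n * codeLen s))) λ ν
                → IsSoftAdvDist g ν × (khrapchenkoValue μ ≤ softAdvValue ν)
lemma6p12 s n f enc enc-inj g g∘encode≡f μ khr with support-inhabited μ
... | _ , e∈ =
  push μ , pushed-softAdv , pairValue-≤-push μ e∈ (khrapchenko-pair-≢ f μ khr e∈)
  where
  open Pushforward (FinP._≟_ {s}) Bool._≟_ (encodeWord enc) (encodeWord-injective enc enc-inj)
                   (block enc) (encodeWord-local enc)

  pushed-softAdv : IsSoftAdvDist g (push μ)
  pushed-softAdv = All.map⁺ (All.map (λ {(_ , (a , b))} (fa , fb , _) →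
                     trans (g∘encode≡f a) fa , trans (g∘encode≡f b) fb) khr)
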